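{- For $x \in \mathbb{C}$, $l \in \mathbb{N}_0$ and $n\in\mathbb{N}_0$, $$\sum_{k=1}^n k^3 H_k^{(l+4)}(x) = \frac{(n-x)(x+n+1)(x^2+x+n+n^2)}{4} H_n^{(l+4)}(x) + \frac{x(x+1)(2x+1)}{2} H_n^{(l+3)}(x) - \frac{6x^2+6x+1}{4} H_n^{(l+2)}(x) + \frac{2x+1}{2} H_n^{(l+1)}(x) - \frac{H_n^{(l)}(x)}{4}.$$
   Context: For $x\in\mathbb{C}$ and $l,n\in\mathbb{N}_0$, $H_0^{(l)}(x)=0$ and $H_n^{(l)}(x)=\sum_{k=1}^n \frac{1}{(x+k)^l}$ for $n\ge 1$ (defined whenever $x$ is not one of $-1,\dots,-n$). In particular $H_n^{(0)}(x)=n$. -}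

module Defs where

open import Level using (Level; _⊔_) renaming (suc to lsuc)
open import Data.Nat using (ℕ; zero; suc)
open import Algebra.Bundles using (CommutativeRing)
open import Relation.Nullary using (¬_)

module _ {c ℓ : Level} (R : CommutativeRing c ℓ) where
  open CommutativeRing R

  ringFromℕ : ℕ → Carrier
  ringFromℕ zero    = 0#
  ringFromℕ (suc n) = 1# + ringFromℕ n

-- A field of characteristic zero (ℂ is one).  The inverse is a total function
-- whose value is only constrained at nonzero elements (it is only ever applied
-- to nonzero elements below, thanks to the hypotheses of the theorem).
record CharZeroField (c ℓ : Level) : Set (lsuc (c ⊔ ℓ)) where
  field
    commutativeRing : CommutativeRing c ℓ
  open CommutativeRing commutativeRing public
  field
    _⁻¹        : Carrier → Carrier
    ⁻¹-cong    : ∀ {x y} → x ≈ y → x ⁻¹ ≈ y ⁻¹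
    ⁻¹-inverse : ∀ x → ¬ (x ≈ 0#) → x * (x ⁻¹) ≈ 1#
    charZero   : ∀ n → ¬ (ringFromℕ commutativeRing (suc n) ≈ 0#)

module FieldDefs {c ℓ : Level} (F : CharZeroField c ℓ) where
  open CharZeroField F

  fromℕ : ℕ → Carrier
  fromℕ = ringFromℕ commutativeRing

  _^_ : Carrier → ℕ → Carrier
  a ^ zero  = 1#
  a ^ suc n = a * (a ^ n)

  sum1 : ℕ → (ℕ → Carrier) → Carrier
  sum1 zero    f = 0#
  sum1 (suc n) f = sum1 n f + f (suc n)

  H : ℕ → ℕ → Carrier → Carrier
  H l n x = sum1 n (λ k → ((x + fromℕ k) ^ l) ⁻¹)

module Submission where

-- Write y = x + (n+1) and t_j = 1/y^(l+j).  Passing from n to n+1 adds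
-- (n+1)^3 (H_n^(l+4) + t_4) to the left-hand side, while every harmonic
-- number H_n^(l+j) on the right gains t_j = y^(4-j) t_4.  After clearing the
-- denominators 4 and 2, the theorem is therefore an induction whose step is a
-- single polynomial identity in x, n, the five harmonic numbers and t_4,
-- and the division by 4 is a second, linear, identity.

open import Defs
open import Level using (Level)
open import Algebra.Bundles using (CommutativeRing; RawRing)
open import Data.Nat using (ℕ; zero; suc; _≤_; s≤s; z≤n) renaming (_+_ to _+ℕ_)
import Data.Nat.Properties as ℕP
open import Relation.Nullary using (¬_; yes; no)
open import Relation.Binary.PropositionalEquality as ≡ using (_≡_)

-- Every commutative ring receives a ring homomorphism from ℤ, so the
-- standard library's ring solver can be run with integer coefficients.
module IntegerCoefficients {c ℓ : Level} (R : CommutativeRing c ℓ) where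
  import Data.Nat as ℕ
  open import Data.Integer as ℤ using (ℤ; +_; -[1+_]; _⊖_; ∣_∣; sign)
  import Data.Integer.Properties as ℤP
  open import Data.Sign as Sign using (Sign)
  open import Data.Maybe using (Maybe; just; nothing)
  open import Algebra.Solver.Ring.AlmostCommutativeRing
    using (AlmostCommutativeRing; _-Raw-AlmostCommutative⟶_; fromCommutativeRing)
  open CommutativeRing R
  open import Algebra.Properties.Ring ring
    using (-1*x≈-x; -0#≈0#; -‿involutive; -‿+-comm)
  open import Algebra.Properties.Semiring.Mult.TCOptimised semiring
    using (_×_; ×-homo-+; ×1-homo-*)
  open import Algebra.Properties.CommutativeSemigroup +-commutativeSemigroup
    using () renaming (interchange to +-interchange)
  open import Algebra.Properties.CommutativeSemigroup *-commutativeSemigroup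
    using () renaming (interchange to *-interchange)
  open import Relation.Binary.Reasoning.Setoid setoid

  -- The image of an integer; 1 ↦ 1# and 0 ↦ 0# hold definitionally.
  ⟦_⟧ᶻ : ℤ → Carrier
  ⟦ + n ⟧ᶻ      = n × 1#
  ⟦ -[1+ n ] ⟧ᶻ = - (suc n × 1#)

  ⊖-homo : ∀ m n → ⟦ m ⊖ n ⟧ᶻ ≈ m × 1# - n × 1#
  ⊖-homo zero    zero    = sym (-‿inverseʳ 0#)
  ⊖-homo zero    (suc n) = sym (+-identityˡ _)
  ⊖-homo (suc m) zero    = begin
    suc m × 1#          ≈⟨ +-identityʳ _ ⟨
    suc m × 1# + 0#     ≈⟨ +-congˡ -0#≈0# ⟨
    suc m × 1# - 0#     ∎
  ⊖-homo (suc m) (suc n) = begin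
    ⟦ suc m ⊖ suc n ⟧ᶻ              ≡⟨ ≡.cong ⟦_⟧ᶻ (ℤP.[1+m]⊖[1+n]≡m⊖n m n) ⟩
    ⟦ m ⊖ n ⟧ᶻ                      ≈⟨ ⊖-homo m n ⟩
    m × 1# - n × 1#                 ≈⟨ +-identityˡ _ ⟨
    0# + (m × 1# - n × 1#)          ≈⟨ +-congʳ (-‿inverseʳ 1#) ⟨
    (1# - 1#) + (m × 1# - n × 1#)   ≈⟨ +-interchange 1# (- 1#) (m × 1#) (- (n × 1#)) ⟩
    (1# + m × 1#) + (- 1# - n × 1#) ≈⟨ +-congˡ (-‿+-comm 1# (n × 1#)) ⟩
    (1# + m × 1#) - (1# + n × 1#)   ≈⟨ +-cong (×-homo-+ 1# 1 m) (-‿cong (×-homo-+ 1# 1 n)) ⟨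
    suc m × 1# - suc n × 1#         ∎

  ⟦_⟧ˢ : Sign → Carrier
  ⟦ Sign.+ ⟧ˢ = 1#
  ⟦ Sign.- ⟧ˢ = - 1#

  ⟦⟧ˢ-homo : ∀ s t → ⟦ s Sign.* t ⟧ˢ ≈ ⟦ s ⟧ˢ * ⟦ t ⟧ˢ
  ⟦⟧ˢ-homo Sign.+ t      = sym (*-identityˡ _)
  ⟦⟧ˢ-homo Sign.- Sign.+ = sym (*-identityʳ _)
  ⟦⟧ˢ-homo Sign.- Sign.- = begin
    1#             ≈⟨ -‿involutive 1# ⟨
    - - 1#         ≈⟨ -1*x≈-x (- 1#) ⟨
    - 1# * - 1#    ∎

  ◃-homo : ∀ s k → ⟦ s ℤ.◃ k ⟧ᶻ ≈ ⟦ s ⟧ˢ * (k × 1#)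
  ◃-homo s      zero    = sym (zeroʳ _)
  ◃-homo Sign.+ (suc k) = sym (*-identityˡ _)
  ◃-homo Sign.- (suc k) = sym (-1*x≈-x _)

  sign-abs : ∀ i → ⟦ i ⟧ᶻ ≈ ⟦ sign i ⟧ˢ * (∣ i ∣ × 1#)
  sign-abs (+ n)    = sym (*-identityˡ _)
  sign-abs -[1+ n ] = sym (-1*x≈-x _)

  *-homo : ∀ i j → ⟦ i ℤ.* j ⟧ᶻ ≈ ⟦ i ⟧ᶻ * ⟦ j ⟧ᶻ
  *-homo i j = begin
    ⟦ i ℤ.* j ⟧ᶻ
      ≈⟨ ◃-homo (sign i Sign.* sign j) (∣ i ∣ ℕ.* ∣ j ∣) ⟩
    ⟦ sign i Sign.* sign j ⟧ˢ * ((∣ i ∣ ℕ.* ∣ j ∣) × 1#)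
      ≈⟨ *-cong (⟦⟧ˢ-homo (sign i) (sign j)) (×1-homo-* ∣ i ∣ ∣ j ∣) ⟩
    (⟦ sign i ⟧ˢ * ⟦ sign j ⟧ˢ) * ((∣ i ∣ × 1#) * (∣ j ∣ × 1#))
      ≈⟨ *-interchange _ _ _ _ ⟩
    (⟦ sign i ⟧ˢ * (∣ i ∣ × 1#)) * (⟦ sign j ⟧ˢ * (∣ j ∣ × 1#))
      ≈⟨ *-cong (sign-abs i) (sign-abs j) ⟨
    ⟦ i ⟧ᶻ * ⟦ j ⟧ᶻ ∎

  +-homo : ∀ i j → ⟦ i ℤ.+ j ⟧ᶻ ≈ ⟦ i ⟧ᶻ + ⟦ j ⟧ᶻ
  +-homo -[1+ m ] -[1+ n ] = begin
    - (suc (suc (m ℕ.+ n)) × 1#)       ≡⟨ ≡.cong (λ k → - (suc k × 1#)) (ℕP.+-suc m n) ⟨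
    - ((suc m ℕ.+ suc n) × 1#)         ≈⟨ -‿cong (×-homo-+ 1# (suc m) (suc n)) ⟩
    - (suc m × 1# + suc n × 1#)        ≈⟨ -‿+-comm _ _ ⟨
    - (suc m × 1#) + - (suc n × 1#)    ∎
  +-homo -[1+ m ] (+ n) = trans (⊖-homo n (suc m)) (+-comm _ _)
  +-homo (+ m) -[1+ n ] = ⊖-homo m (suc n)
  +-homo (+ m) (+ n)    = ×-homo-+ 1# m n

  -‿homo : ∀ i → ⟦ ℤ.- i ⟧ᶻ ≈ - ⟦ i ⟧ᶻ
  -‿homo (+ zero)  = sym -0#≈0#
  -‿homo (+ suc n) = refl
  -‿homo -[1+ n ]  = sym (-‿involutive _)

  ring′ : AlmostCommutativeRing c ℓ
  ring′ = fromCommutativeRing R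

  ℤ-homomorphism : ℤ.+-*-rawRing -Raw-AlmostCommutative⟶ ring′
  ℤ-homomorphism = record
    { ⟦_⟧ = ⟦_⟧ᶻ ; +-homo = +-homo ; *-homo = *-homo ; -‿homo = -‿homo
    ; 0-homo = refl ; 1-homo = refl }

  coefficient-equality : ∀ i j → Maybe (⟦ i ⟧ᶻ ≈ ⟦ j ⟧ᶻ)
  coefficient-equality i j with i ℤ.≟ j
  ... | yes ≡.refl = just refl
  ... | no _       = nothing

  open import Algebra.Solver.Ring ℤ.+-*-rawRing ring′ ℤ-homomorphism coefficient-equality public
    using (Polynomial; con; _:+_; _:*_; :-_; _:=_; solve)

  polynomials : ℕ → RawRing _ _
  polynomials n = record
    { Carrier = Polynomial n ; _≈_ = _≡_ ; _+_ = _:+_ ; _*_ = _:*_ ; -_ = :-_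
    ; 0# = con (+ 0) ; 1# = con (+ 1) }

-- Numerals and
-- powers are built exactly as in Defs, so over a field the definitions below
-- unfold to the expressions of the theorem.
module Coefficients {c ℓ : Level} (R : RawRing c ℓ) where
  open RawRing R

  infixl 6 _-_
  infixr 8 _^_

  _-_ : Carrier → Carrier → Carrier
  a - b = a + - b

  num : ℕ → Carrier
  num zero    = 0#
  num (suc n) = 1# + num n

  _^_ : Carrier → ℕ → Carrier
  a ^ zero  = 1#
  a ^ suc n = a * a ^ n

  -- 4 × coefficient of H^(l+4), as a function of x and m = n
  P : Carrier → Carrier → Carrier
  P x m = (m - x) * (x + m + 1#) * ((x ^ 2) + x + m + (m ^ 2))

  -- 2 × coefficient of H^(l+3)
  B : Carrier → Carrier
  B x = x * (x + 1#) * (num 2 * x + 1#)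

  -- 4 × coefficient of H^(l+2) (which enters with a minus sign)
  C : Carrier → Carrier
  C x = num 6 * (x ^ 2) + num 6 * x + 1#

  -- 2 × coefficient of H^(l+1)
  D : Carrier → Carrier
  D x = num 2 * x + 1#

  -- Four times the right-hand side of the theorem, with h_j standing for H^(l+j).
  combination : (x m h₀ h₁ h₂ h₃ h₄ : Carrier) → Carrier
  combination x m h₀ h₁ h₂ h₃ h₄ =
    P x m * h₄ + num 2 * B x * h₃ - C x * h₂ + num 2 * D x * h₁ - h₀

  -- The combination at m+1 when each h_j has gained y^(4-j)·t, y = x+m+1
  -- (this is what happens to H_n^(l+j)(x) when n grows by one).
  shifted : (x m h₀ h₁ h₂ h₃ h₄ t : Carrier) → Carrier
  shifted x m h₀ h₁ h₂ h₃ h₄ t =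
    combination x M (h₀ + y ^ 4 * t) (h₁ + y ^ 3 * t) (h₂ + y ^ 2 * t) (h₃ + y ^ 1 * t) (h₄ + t)
    where
    M = 1# + m
    y = x + M

  -- The right-hand side of the theorem with 1/4 and 1/2 abstracted to q and h.
  rhs : (x m q h h₀ h₁ h₂ h₃ h₄ : Carrier) → Carrier
  rhs x m q h h₀ h₁ h₂ h₃ h₄ =
    (P x m * q) * h₄ + (B x * h) * h₃ - (C x * q) * h₂ + (D x * h) * h₁ - h₀ * q

module FieldInverses {c ℓ : Level} (F : CharZeroField c ℓ) where
  open CharZeroField F
  open FieldDefs F
  open import Relation.Binary.Reasoning.Setoid setoid

  1≉0 : ¬ (1# ≈ 0#)
  1≉0 1≈0 = charZero 0 (trans (+-identityʳ 1#) 1≈0)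

  ⁻¹-inverseˡ : ∀ {a} → ¬ (a ≈ 0#) → a ⁻¹ * a ≈ 1#
  ⁻¹-inverseˡ {a} a≉0 = trans (*-comm (a ⁻¹) a) (⁻¹-inverse a a≉0)

  ⁻¹-unique : ∀ {a b} → ¬ (a ≈ 0#) → a * b ≈ 1# → a ⁻¹ ≈ b
  ⁻¹-unique {a} {b} a≉0 ab≈1 = begin
    a ⁻¹              ≈⟨ *-identityʳ _ ⟨
    a ⁻¹ * 1#         ≈⟨ *-congˡ ab≈1 ⟨
    a ⁻¹ * (a * b)    ≈⟨ *-assoc _ _ _ ⟨
    (a ⁻¹ * a) * b    ≈⟨ *-congʳ (⁻¹-inverseˡ a≉0) ⟩
    1# * b            ≈⟨ *-identityˡ b ⟩
    b                 ∎

  *-nonzero : ∀ {a b} → ¬ (a ≈ 0#) → ¬ (b ≈ 0#) → ¬ (a * b ≈ 0#)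
  *-nonzero {a} {b} a≉0 b≉0 ab≈0 = b≉0 (begin
    b                 ≈⟨ *-identityˡ b ⟨
    1# * b            ≈⟨ *-congʳ (⁻¹-inverseˡ a≉0) ⟨
    (a ⁻¹ * a) * b    ≈⟨ *-assoc _ _ _ ⟩
    a ⁻¹ * (a * b)    ≈⟨ *-congˡ ab≈0 ⟩
    a ⁻¹ * 0#         ≈⟨ zeroʳ _ ⟩
    0#                ∎)

  ^-nonzero : ∀ {a} → ¬ (a ≈ 0#) → ∀ k → ¬ (a ^ k ≈ 0#)
  ^-nonzero a≉0 zero    = 1≉0
  ^-nonzero a≉0 (suc k) = *-nonzero a≉0 (^-nonzero a≉0 k)

  ^-homo-+ : ∀ a e k → a ^ (e +ℕ k) ≈ a ^ e * a ^ k
  ^-homo-+ a zero    k = sym (*-identityˡ _)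
  ^-homo-+ a (suc e) k = trans (*-congˡ (^-homo-+ a e k)) (sym (*-assoc _ _ _))

  -- 1/a^e = a^k · 1/a^(e+k): how a tail term of H^(l+j) relates to one of
  -- H^(l+j+k).
  ⁻¹-shift : ∀ {a} → ¬ (a ≈ 0#) → ∀ e k → (a ^ e) ⁻¹ ≈ a ^ k * (a ^ (e +ℕ k)) ⁻¹
  ⁻¹-shift {a} a≉0 e k = ⁻¹-unique (^-nonzero a≉0 e) (begin
    a ^ e * (a ^ k * (a ^ (e +ℕ k)) ⁻¹)   ≈⟨ *-assoc _ _ _ ⟨
    (a ^ e * a ^ k) * (a ^ (e +ℕ k)) ⁻¹   ≈⟨ *-congʳ (^-homo-+ a e k) ⟨
    a ^ (e +ℕ k) * (a ^ (e +ℕ k)) ⁻¹      ≈⟨ ⁻¹-inverse _ (^-nonzero a≉0 (e +ℕ k)) ⟩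
    1#                                    ∎)

module Identities {c ℓ : Level} (R : CommutativeRing c ℓ) where
  open CommutativeRing R
  open IntegerCoefficients R using (solve; _:=_; con; _:+_; _:*_; polynomials)
  open Coefficients rawRing using (num; _^_; B; D; combination; shifted; rhs)
  open import Data.Integer using (+_)

  combination-step : ∀ x m h₀ h₁ h₂ h₃ h₄ t →
    shifted x m h₀ h₁ h₂ h₃ h₄ t ≈ combination x m h₀ h₁ h₂ h₃ h₄ + num 4 * (1# + m) ^ 3 * (h₄ + t)
  combination-step = solve 8 (λ x m h₀ h₁ h₂ h₃ h₄ t →
    Step.shifted x m h₀ h₁ h₂ h₃ h₄ t
      := Step.combination x m h₀ h₁ h₂ h₃ h₄ :+ Step.num 4 :* ((con (+ 1) :+ m) Step.^ 3) :* (h₄ :+ t)) refl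
    where module Step = Coefficients (polynomials 8)

  combination-zero : ∀ x m → combination x m 0# 0# 0# 0# 0# ≈ 0#
  combination-zero = solve 2 (λ x m →
    Zero.combination x m (con (+ 0)) (con (+ 0)) (con (+ 0)) (con (+ 0)) (con (+ 0)) := con (+ 0)) refl
    where module Zero = Coefficients (polynomials 2)

  -- With h = 2q the right-hand side is q times the combination; the defect
  -- for arbitrary h is recorded explicitly.
  rhs-factor : ∀ x m q h h₀ h₁ h₂ h₃ h₄ →
    rhs x m q h h₀ h₁ h₂ h₃ h₄
      ≈ q * combination x m h₀ h₁ h₂ h₃ h₄ + (h - num 2 * q) * (B x * h₃ + D x * h₁)
  rhs-factor = solve 9 (λ x m q h h₀ h₁ h₂ h₃ h₄ →
    Factor.rhs x m q h h₀ h₁ h₂ h₃ h₄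
      := q :* Factor.combination x m h₀ h₁ h₂ h₃ h₄
         :+ (h Factor.- Factor.num 2 :* q) :* (Factor.B x :* h₃ :+ Factor.D x :* h₁)) refl
    where module Factor = Coefficients (polynomials 9)

  two-twos : num 2 * num 2 ≈ num 4
  two-twos = solve 0 (Numerals.num 2 :* Numerals.num 2 := Numerals.num 4) refl
    where module Numerals = Coefficients (polynomials 0)

  combination-cong : ∀ x m {h₀ h₁ h₂ h₃ h₄ h₀′ h₁′ h₂′ h₃′ h₄′} →
    h₀ ≈ h₀′ → h₁ ≈ h₁′ → h₂ ≈ h₂′ → h₃ ≈ h₃′ → h₄ ≈ h₄′ →
    combination x m h₀ h₁ h₂ h₃ h₄ ≈ combination x m h₀′ h₁′ h₂′ h₃′ h₄′
  combination-cong x m e₀ e₁ e₂ e₃ e₄ =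
    +-cong (+-cong (+-cong (+-cong (*-congˡ e₄) (*-congˡ e₃)) (-‿cong (*-congˡ e₂))) (*-congˡ e₁))
           (-‿cong e₀)

module HarmonicCubeSum {c ℓ : Level} (F : CharZeroField c ℓ) (x : CharZeroField.Carrier F) (l : ℕ) where
  open CharZeroField F
  open FieldDefs F
  open FieldInverses F
  open Identities commutativeRing
  open Coefficients rawRing using (combination; shifted; rhs)
  open import Relation.Binary.Reasoning.Setoid setoid

  -- x + k ≠ 0 for 1 ≤ k ≤ n, so that H_n^(j)(x) is defined
  Admissible : ℕ → Set ℓ
  Admissible n = ∀ k → 1 ≤ k → k ≤ n → ¬ (x + fromℕ k ≈ 0#)

  cube-sum : ℕ → Carrier
  cube-sum n = sum1 n (λ k → (fromℕ k ^ 3) * H (l +ℕ 4) k x)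

  combination-at : ℕ → Carrier
  combination-at n =
    combination x (fromℕ n) (H l n x) (H (l +ℕ 1) n x) (H (l +ℕ 2) n x) (H (l +ℕ 3) n x) (H (l +ℕ 4) n x)

  quarter half : Carrier
  quarter = fromℕ 4 ⁻¹
  half    = fromℕ 2 ⁻¹

  rhs-at : ℕ → Carrier
  rhs-at n =
    rhs x (fromℕ n) quarter half (H l n x) (H (l +ℕ 1) n x) (H (l +ℕ 2) n x) (H (l +ℕ 3) n x) (H (l +ℕ 4) n x)

  tail-shift : ∀ {y} → ¬ (y ≈ 0#) → ∀ j k → (y ^ (l +ℕ j)) ⁻¹ ≈ y ^ k * (y ^ (l +ℕ (j +ℕ k))) ⁻¹
  tail-shift {y} y≉0 j k = trans (⁻¹-shift y≉0 (l +ℕ j) k)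
    (*-congˡ (⁻¹-cong (reflexive (≡.cong (y ^_) (ℕP.+-assoc l j k)))))

  cleared : ∀ n → Admissible n → fromℕ 4 * cube-sum n ≈ combination-at n
  cleared zero    _  = trans (zeroʳ _) (sym (combination-zero x 0#))
  cleared (suc n) ok = begin
    fromℕ 4 * (cube-sum n + M ^ 3 * (h₄ + t₄))
      ≈⟨ distribˡ _ _ _ ⟩
    fromℕ 4 * cube-sum n + fromℕ 4 * (M ^ 3 * (h₄ + t₄))
      ≈⟨ +-cong (cleared n ok′) (sym (*-assoc _ _ _)) ⟩
    combination-at n + fromℕ 4 * M ^ 3 * (h₄ + t₄)
      ≈⟨ combination-step x m h₀ h₁ h₂ h₃ h₄ t₄ ⟨
    shifted x m h₀ h₁ h₂ h₃ h₄ t₄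
      ≈⟨ combination-cong x M (+-congˡ (sym (⁻¹-shift y≉0 l 4)))
           (+-congˡ (sym (tail-shift y≉0 1 3))) (+-congˡ (sym (tail-shift y≉0 2 2)))
           (+-congˡ (sym (tail-shift y≉0 3 1))) refl ⟩
    combination-at (suc n) ∎
    where
    m = fromℕ n
    M = 1# + m
    y = x + M
    y≉0 : ¬ (y ≈ 0#)
    y≉0 = ok (suc n) (s≤s z≤n) ℕP.≤-refl
    ok′ : Admissible n
    ok′ k 1≤k k≤n = ok k 1≤k (ℕP.m≤n⇒m≤1+n k≤n)
    h₀ = H l n x
    h₁ = H (l +ℕ 1) n x
    h₂ = H (l +ℕ 2) n x
    h₃ = H (l +ℕ 3) n x
    h₄ = H (l +ℕ 4) n x
    t₄ = (y ^ (l +ℕ 4)) ⁻¹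

  quarter-cancel : ∀ a → a ≈ quarter * (fromℕ 4 * a)
  quarter-cancel a = begin
    a                          ≈⟨ *-identityˡ a ⟨
    1# * a                     ≈⟨ *-congʳ (⁻¹-inverseˡ (charZero 3)) ⟨
    (quarter * fromℕ 4) * a    ≈⟨ *-assoc _ _ _ ⟩
    quarter * (fromℕ 4 * a)    ∎

  half≈2·quarter : half ≈ fromℕ 2 * quarter
  half≈2·quarter = ⁻¹-unique (charZero 1) (begin
    fromℕ 2 * (fromℕ 2 * quarter)   ≈⟨ *-assoc _ _ _ ⟨
    (fromℕ 2 * fromℕ 2) * quarter   ≈⟨ *-congʳ two-twos ⟩
    fromℕ 4 * quarter               ≈⟨ ⁻¹-inverse _ (charZero 3) ⟩
    1#                              ∎)

  rhs-cleared : ∀ n → rhs-at n ≈ quarter * combination-at n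
  rhs-cleared n = begin
    rhs-at n                                          ≈⟨ rhs-factor x (fromℕ n) quarter half _ _ _ _ _ ⟩
    quarter * combination-at n + (half - fromℕ 2 * quarter) * _
                                                      ≈⟨ +-congˡ (*-congʳ (trans (+-congʳ half≈2·quarter) (-‿inverseʳ _))) ⟩
    quarter * combination-at n + 0# * _               ≈⟨ +-congˡ (zeroˡ _) ⟩
    quarter * combination-at n + 0#                   ≈⟨ +-identityʳ _ ⟩
    quarter * combination-at n                        ∎

theorem19 : ∀ {c ℓ : Level} (F : CharZeroField c ℓ) →
    let open CharZeroField F in
    let open FieldDefs F in
    (x : Carrier) (l n : ℕ) →
    (∀ k → 1 ≤ k → k ≤ n → ¬ (x + fromℕ k ≈ 0#)) →
    sum1 n (λ k → (fromℕ k ^ 3) * H (l +ℕ 4) k x)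
    ≈ ((((fromℕ n - x) * (x + fromℕ n + 1#) * ((x ^ 2) + x + fromℕ n + (fromℕ n ^ 2))) * (fromℕ 4 ⁻¹)) * H (l +ℕ 4) n x
    + ((x * (x + 1#) * (fromℕ 2 * x + 1#)) * (fromℕ 2 ⁻¹)) * H (l +ℕ 3) n x
    - ((fromℕ 6 * (x ^ 2) + fromℕ 6 * x + 1#) * (fromℕ 4 ⁻¹)) * H (l +ℕ 2) n x
    + ((fromℕ 2 * x + 1#) * (fromℕ 2 ⁻¹)) * H (l +ℕ 1) n x
    - H l n x * (fromℕ 4 ⁻¹))
theorem19 F x l n admissible = begin
    cube-sum n                          ≈⟨ quarter-cancel (cube-sum n) ⟩
    quarter * (fromℕ 4 * cube-sum n)    ≈⟨ *-congˡ (cleared n admissible) ⟩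
    quarter * combination-at n          ≈⟨ rhs-cleared n ⟨
    rhs-at n                            ∎
  where
  open CharZeroField F
  open FieldDefs F
  open HarmonicCubeSum F x l
  open import Relation.Binary.Reasoning.Setoid setoid
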